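{- Let $n\geq r\geq 2$. Let $H$ be the $r$-uniform hypergraph with vertex set $V=V_1\cup\dots\cup V_r$ (a partition), where $|V|=n$, any two parts differ in size by at most two, and $|V_1|,\dots,|V_{r-1}|$ are odd, and with edge set $$E=\{e\subseteq V: |e|=r\}\setminus\{e\subseteq V: |e|=r,\ |e\cap V_1|=\dots=|e\cap V_r|=1\}.$$ Then $\delta_{r-1}(H)\geq (r-1)n/r-C$ for a constant $C$ depending only on $r$ (i.e. $\delta_{r-1}(H)\ge (r-1)n/r-\mathcal{O}(1)$), and $H$ contains no $(r-1,r,n)$-Steiner system.
   Context: For an $r$-uniform hypergraph $H$, the degree of an $(r-1)$-set $p$ of vertices is the number of edges containing $p$, and $\delta_{r-1}(H)$ is the minimum of this over all $(r-1)$-subsets of $V(H)$. An $(r-1,r,n)$-Steiner system in $H$ is a subhypergraph $S\subseteq H$ with $V(S)=V(H)$ (where $|V(H)|=n$) such that every $(r-1)$-subset of $V(H)$ is contained in exactly one edge of $S$. -}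

module Defs where

open import Data.Nat using (ℕ; zero; suc; _≤_; _+_; _*_; _∸_)
open import Data.Nat.Divisibility using (_∣_)
open import Data.Bool using (true; false)
open import Data.Fin using (Fin; toℕ; _<_)
open import Data.Fin as Fin using ()
open import Data.Fin.Subset using (Subset; ∣_∣; _∩_; _⊆_; inside; outside)
open import Data.Fin.Subset.Properties using (_⊆?_)
open import Data.List using (List; []; _∷_; map; _++_; filter; length)
open import Data.Vec using (_∷_; []; tabulate)
open import Data.Product using (Σ; _×_; _,_; ∃)
open import Relation.Nullary using (¬_; Dec; yes; no)
open import Relation.Nullary.Decidable using (isYes; _×-dec_; ¬?)
open import Relation.Binary.PropositionalEquality using (_≡_)
open import Relation.Unary using (Decidable)

record Hypergraph (n : ℕ) : Set₁ where
  field
    Edge  : Subset n → Set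
    edge? : Decidable Edge
open Hypergraph public

Uniform : ∀ {n} → ℕ → Hypergraph n → Set
Uniform r H = ∀ e → Edge H e → ∣ e ∣ ≡ r

allSubsets : (n : ℕ) → List (Subset n)
allSubsets zero    = [] ∷ []
allSubsets (suc n) = map (outside ∷_) (allSubsets n) ++ map (inside ∷_) (allSubsets n)

degree : ∀ {n} → Hypergraph n → Subset n → ℕ
degree {n} H p = length (filter (λ e → edge? H e ×-dec (p ⊆? e)) (allSubsets n))

-- δ_{r-1}(H) ≥ (r-1)n/r - C, i.e. every (r-1)-set p has degree d(p) with
-- d(p) ≥ (r-1)n/r - C, written without division as (r-1)·n ≤ r·(d(p) + C).
MinCodegreeBound : ∀ {n} → (r : ℕ) → Hypergraph n → (C : ℕ) → Set
MinCodegreeBound {n} r H C =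
  ∀ (p : Subset n) → ∣ p ∣ ≡ r ∸ 1 → (r ∸ 1) * n ≤ r * (degree H p + C)

IsSteinerSystemIn : ∀ {n} → ℕ → Hypergraph n → (Subset n → Set) → Set
IsSteinerSystemIn {n} r H S =
  (∀ e → S e → Edge H e) ×
  (∀ (p : Subset n) → ∣ p ∣ ≡ r ∸ 1 →
     Σ (Subset n) λ e → S e × p ⊆ e × (∀ e′ → S e′ → p ⊆ e′ → e′ ≡ e))

ContainsSteinerSystem : ∀ {n} → ℕ → Hypergraph n → Set₁
ContainsSteinerSystem r H = ∃ λ S → IsSteinerSystemIn r H S

Part : ∀ {n r} → (Fin n → Fin r) → Fin r → Subset n
Part part i = tabulate (λ v → isYes (part v Fin.≟ i))

Transversal : ∀ {n r} → (Fin n → Fin r) → Subset n → Set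
Transversal part e = ∀ i → ∣ e ∩ Part part i ∣ ≡ 1

transversal? : ∀ {n r} (part : Fin n → Fin r) → Decidable (Transversal part)
transversal? {r = r} part e = Data.Fin.Properties.all? (λ i → ∣ e ∩ Part part i ∣ Data.Nat.≟ 1)
  where import Data.Fin.Properties
        import Data.Nat

Hconstr : ∀ {n} (r : ℕ) → (Fin n → Fin r) → Hypergraph n
Hconstr r part = record
  { Edge  = λ e → ∣ e ∣ ≡ r × ¬ Transversal part e
  ; edge? = λ e → (∣ e ∣ Data.Nat.≟ r) ×-dec ¬? (transversal? part e) }
  where import Data.Nat

{-# OPTIONS --safe #-}
module Submission where

-- Let p be an (r-1)-set. If some p ∪ {v₀} is transversal, p misses the part
-- V_j of v₀, and then p ∪ {v} is not transversal for every v ∉ p ∪ V_j; otherwise this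
-- holds for every v ∉ p and any j. Either way deg(p) ≥ n - (r-1) - |V_j|, and balanced
-- parts give r|V_j| ≤ n + 2r, whence (r-1)n ≤ r(deg(p) + r + 1).
--
-- Call p a near-transversal if it meets V_1, …, V_{r-1} once and
-- misses V_r. There are ∏_{i<r} |V_i| of them, an odd number. In a Steiner system S the
-- S-edge through a near-transversal p is p ∪ {v} with v ∉ V_r (it is not transversal),
-- so it meets the part of v twice and contains exactly one other near-transversal,
-- namely the one dropping the vertex of p in that part. Sharing an S-edge is therefore a
-- perfect matching on the near-transversals, and their number would be even.

open import Defs
import Data.Nat.Properties as ℕ
open import Algebra.Properties.CommutativeMonoid.Sum ℕ.+-0-commutativeMonoid
  using (sum; sum-syntax; sum-cong-≗; sum-remove; sum-init-last; ∑-distrib-+; sum-replicate-zero)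
open import Algebra.Properties.CommutativeMonoid.Sum ℕ.*-1-commutativeMonoid
  using () renaming (sum to product; sum-cong-≗ to product-cong; sum-remove to product-remove;
                     sum-replicate-zero to product-replicate-one)
open import Data.Bool.Base using (Bool; true; false; not; _∧_; if_then_else_)
open import Data.Bool.Properties using (not-¬)
import Data.Bool.Properties as Bool
open import Data.Fin.Base using (Fin; zero; suc; toℕ; fromℕ; inject₁; punchIn)
open import Data.Fin.Properties
  using (_≟_; any?; all?; ¬∀⟶∃¬; punchInᵢ≢i; fromℕ≢inject₁; toℕ-fromℕ; toℕ-injective; toℕ≤pred[n])
open import Data.Fin.Subset
open import Data.Fin.Subset.Properties
open import Data.List.Base using (List; []; _∷_; length; filter; map; _++_)
open import Data.List.Properties using (filter-++; length-++; filter-≐; filter-none; filter-accept; filter-reject)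
open import Data.List.Relation.Unary.All as All using ([]; _∷_)
open import Data.List.Relation.Unary.All.Properties using (all-filter)
open import Data.Nat.Base using (ℕ; zero; suc; pred; _+_; _*_; _∸_; _≤_; _<_; z≤n; s≤s; z<s)
open import Data.Nat.Combinatorics using (_C_; nC1≡n; nCk+nC[k+1]≡[n+1]C[k+1])
open import Data.Nat.Divisibility using (_∣_; _∣0; ∣1⇒≡1; ∣m∣n⇒∣m+n; ∣-refl)
open import Data.Nat.Primality using (prime[2]; euclidsLemma)
open import Data.Nat.Tactic.RingSolver using (solve-∀)
open import Data.Product.Base using (∃; ∃₂; ∃-syntax; Σ; _×_; _,_; proj₁; map₂)
open import Data.Sum.Base using (inj₁; inj₂)
open import Data.Vec.Base using ([]; _∷_; here; there)
open import Data.Vec.Functional using (updateAt; removeAt)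
open import Data.Vec.Functional.Properties using (updateAt-updates; updateAt-minimal)
open import Data.Vec.Properties using (∷-injectiveˡ; ∷-injectiveʳ; ≡-dec)
open import Function.Base using (_∘_; flip)
open import Level using (Level; 0ℓ)
open import Relation.Binary.Core using (Rel)
open import Relation.Binary.Definitions using (Symmetric)
open import Relation.Binary.PropositionalEquality
open import Relation.Nullary using (¬_; does; yes; no; contradiction; ¬?)
open import Relation.Nullary.Decidable using (isYes; _×-dec_; decidable-stable)
open import Relation.Unary using (Pred; Decidable; _≐_)

private variable
  ℓ ℓ′ : Level
  n r : ℕ
  x y : Fin n
  p q A : Subset n

-- Subsets

∣p∩⊤∣≡∣p∣ : ∀ (p : Subset n) → ∣ p ∩ ⊤ ∣ ≡ ∣ p ∣
∣p∩⊤∣≡∣p∣ p = cong ∣_∣ (∩-identityʳ p)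

∣⊥∩A∣≡0 : ∀ (A : Subset n) → ∣ ⊥ ∩ A ∣ ≡ 0
∣⊥∩A∣≡0 {n} A = trans (cong ∣_∣ (∩-zeroˡ A)) (∣⊥∣≡0 n)

∣⁅x⁆∩A∣≡1 : x ∈ A → ∣ ⁅ x ⁆ ∩ A ∣ ≡ 1
∣⁅x⁆∩A∣≡1 {A = _ ∷ A} here        = cong suc (∣⊥∩A∣≡0 A)
∣⁅x⁆∩A∣≡1             (there x∈A) = ∣⁅x⁆∩A∣≡1 x∈A

∣⁅x⁆∩A∣≡0 : x ∉ A → ∣ ⁅ x ⁆ ∩ A ∣ ≡ 0
∣⁅x⁆∩A∣≡0 {x = zero}  {outside ∷ A} _   = ∣⊥∩A∣≡0 A
∣⁅x⁆∩A∣≡0 {x = zero}  {inside  ∷ A} x∉A = contradiction here x∉A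
∣⁅x⁆∩A∣≡0 {x = suc x} {_       ∷ A} x∉A = ∣⁅x⁆∩A∣≡0 (drop-not-there x∉A)

∣p∩A∣≡∣⁅x⁆∩A∣+∣p-x∩A∣ : x ∈ p → ∣ p ∩ A ∣ ≡ ∣ ⁅ x ⁆ ∩ A ∣ + ∣ (p - x) ∩ A ∣
∣p∩A∣≡∣⁅x⁆∩A∣+∣p-x∩A∣ {p = inside ∷ p} {a ∷ A} here with a
... | true  = cong suc (sym (cong₂ _+_ (∣⊥∩A∣≡0 A) (cong (λ s → ∣ s ∩ A ∣) (p─⊥≡p p))))
... | false = sym (cong₂ _+_ (∣⊥∩A∣≡0 A) (cong (λ s → ∣ s ∩ A ∣) (p─⊥≡p p)))
∣p∩A∣≡∣⁅x⁆∩A∣+∣p-x∩A∣ {p = b ∷ p} {a ∷ A} (there x∈p) with b ∧ a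
... | true  = trans (cong suc (∣p∩A∣≡∣⁅x⁆∩A∣+∣p-x∩A∣ x∈p)) (sym (ℕ.+-suc _ _))
... | false = ∣p∩A∣≡∣⁅x⁆∩A∣+∣p-x∩A∣ x∈p

∣p∪⁅x⁆∩A∣≡∣⁅x⁆∩A∣+∣p∩A∣ : x ∉ p → ∣ (p ∪ ⁅ x ⁆) ∩ A ∣ ≡ ∣ ⁅ x ⁆ ∩ A ∣ + ∣ p ∩ A ∣
∣p∪⁅x⁆∩A∣≡∣⁅x⁆∩A∣+∣p∩A∣ {x = zero} {inside ∷ p} x∉p = contradiction here x∉p
∣p∪⁅x⁆∩A∣≡∣⁅x⁆∩A∣+∣p∩A∣ {x = zero} {outside ∷ p} {a ∷ A} _ with a
... | true  = cong suc (sym (cong₂ _+_ (∣⊥∩A∣≡0 A) (cong (λ s → ∣ s ∩ A ∣) (sym (∪-identityʳ p)))))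
... | false = sym (cong₂ _+_ (∣⊥∩A∣≡0 A) (cong (λ s → ∣ s ∩ A ∣) (sym (∪-identityʳ p))))
∣p∪⁅x⁆∩A∣≡∣⁅x⁆∩A∣+∣p∩A∣ {x = suc x} {inside ∷ p} {a ∷ A} x∉p with a
... | true  = trans (cong suc (∣p∪⁅x⁆∩A∣≡∣⁅x⁆∩A∣+∣p∩A∣ (drop-not-there x∉p))) (sym (ℕ.+-suc _ _))
... | false = ∣p∪⁅x⁆∩A∣≡∣⁅x⁆∩A∣+∣p∩A∣ (drop-not-there x∉p)
∣p∪⁅x⁆∩A∣≡∣⁅x⁆∩A∣+∣p∩A∣ {x = suc x} {outside ∷ p} {a ∷ A} x∉p =
  ∣p∪⁅x⁆∩A∣≡∣⁅x⁆∩A∣+∣p∩A∣ (drop-not-there x∉p)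

∣p∣≡1+∣p-x∣ : x ∈ p → ∣ p ∣ ≡ suc ∣ p - x ∣
∣p∣≡1+∣p-x∣ {x = x} {p} x∈p = begin
  ∣ p ∣                           ≡⟨ ∣p∩⊤∣≡∣p∣ p ⟨
  ∣ p ∩ ⊤ ∣                       ≡⟨ ∣p∩A∣≡∣⁅x⁆∩A∣+∣p-x∩A∣ x∈p ⟩
  ∣ ⁅ x ⁆ ∩ ⊤ ∣ + ∣ (p - x) ∩ ⊤ ∣ ≡⟨ cong₂ _+_ (∣⁅x⁆∩A∣≡1 (∈⊤ {x = x})) (∣p∩⊤∣≡∣p∣ (p - x)) ⟩
  suc ∣ p - x ∣                   ∎
  where open ≡-Reasoning

∣p∪⁅x⁆∣≡1+∣p∣ : x ∉ p → ∣ p ∪ ⁅ x ⁆ ∣ ≡ suc ∣ p ∣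
∣p∪⁅x⁆∣≡1+∣p∣ {x = x} {p} x∉p = begin
  ∣ p ∪ ⁅ x ⁆ ∣             ≡⟨ ∣p∩⊤∣≡∣p∣ (p ∪ ⁅ x ⁆) ⟨
  ∣ (p ∪ ⁅ x ⁆) ∩ ⊤ ∣       ≡⟨ ∣p∪⁅x⁆∩A∣≡∣⁅x⁆∩A∣+∣p∩A∣ x∉p ⟩
  ∣ ⁅ x ⁆ ∩ ⊤ ∣ + ∣ p ∩ ⊤ ∣ ≡⟨ cong₂ _+_ (∣⁅x⁆∩A∣≡1 (∈⊤ {x = x})) (∣p∩⊤∣≡∣p∣ p) ⟩
  suc ∣ p ∣                 ∎
  where open ≡-Reasoning

∣p∪q∣≤∣p∣+∣q∣ : ∀ (p q : Subset n) → ∣ p ∪ q ∣ ≤ ∣ p ∣ + ∣ q ∣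
∣p∪q∣≤∣p∣+∣q∣ []            []            = z≤n
∣p∪q∣≤∣p∣+∣q∣ (outside ∷ p) (outside ∷ q) = ∣p∪q∣≤∣p∣+∣q∣ p q
∣p∪q∣≤∣p∣+∣q∣ (inside  ∷ p) (outside ∷ q) = s≤s (∣p∪q∣≤∣p∣+∣q∣ p q)
∣p∪q∣≤∣p∣+∣q∣ (outside ∷ p) (inside  ∷ q) =
  ℕ.≤-trans (s≤s (∣p∪q∣≤∣p∣+∣q∣ p q)) (ℕ.≤-reflexive (sym (ℕ.+-suc _ _)))
∣p∪q∣≤∣p∣+∣q∣ (inside  ∷ p) (inside  ∷ q) =
  s≤s (ℕ.≤-trans (∣p∪q∣≤∣p∣+∣q∣ p q) (ℕ.+-monoʳ-≤ ∣ p ∣ (ℕ.n≤1+n ∣ q ∣)))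

n≤∣p∣+∣q∣+∣∁[p∪q]∣ : ∀ (p q : Subset n) → n ≤ ∣ p ∣ + ∣ q ∣ + ∣ ∁ (p ∪ q) ∣
n≤∣p∣+∣q∣+∣∁[p∪q]∣ {n} p q = begin
  n                             ≤⟨ ℕ.m≤n+m∸n n ∣ p ∪ q ∣ ⟩
  ∣ p ∪ q ∣ + (n ∸ ∣ p ∪ q ∣)   ≡⟨ cong (∣ p ∪ q ∣ +_) (∣∁p∣≡n∸∣p∣ (p ∪ q)) ⟨
  ∣ p ∪ q ∣ + ∣ ∁ (p ∪ q) ∣     ≤⟨ ℕ.+-monoˡ-≤ ∣ ∁ (p ∪ q) ∣ (∣p∪q∣≤∣p∣+∣q∣ p q) ⟩
  ∣ p ∣ + ∣ q ∣ + ∣ ∁ (p ∪ q) ∣ ∎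
  where open ℕ.≤-Reasoning

x∉p-x : ∀ (p : Subset n) x → x ∉ p - x
x∉p-x (_ ∷ p) zero    ()
x∉p-x (_ ∷ p) (suc x) (there x∈p-x) = x∉p-x p x x∈p-x

x∈p∪⁅x⁆ : ∀ (p : Subset n) x → x ∈ p ∪ ⁅ x ⁆
x∈p∪⁅x⁆ p x = x∈p∪q⁺ (inj₂ (x∈⁅x⁆ x))

q⊆p∪⁅x⁆∧x∉q⇒q⊆p : q ⊆ p ∪ ⁅ x ⁆ → x ∉ q → q ⊆ p
q⊆p∪⁅x⁆∧x∉q⇒q⊆p {q = q} {p} {x} q⊆p∪⁅x⁆ x∉q {y} y∈q with x∈p∪q⁻ p ⁅ x ⁆ (q⊆p∪⁅x⁆ y∈q)
... | inj₁ y∈p   = y∈p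
... | inj₂ y∈⁅x⁆ = contradiction (subst (_∈ q) (x∈⁅y⁆⇒x≡y x y∈⁅x⁆) y∈q) x∉q

p∪⁅x⁆≡p∪⁅y⁆⇒x≡y : x ∉ p → p ∪ ⁅ x ⁆ ≡ p ∪ ⁅ y ⁆ → x ≡ y
p∪⁅x⁆≡p∪⁅y⁆⇒x≡y {x = x} {p} {y} x∉p eq with x∈p∪q⁻ p ⁅ y ⁆ (subst (x ∈_) eq (x∈p∪⁅x⁆ p x))
... | inj₁ x∈p   = contradiction x∈p x∉p
... | inj₂ x∈⁅y⁆ = x∈⁅y⁆⇒x≡y y x∈⁅y⁆

∣p∣>0⇒Nonempty : 0 < ∣ p ∣ → Nonempty p
∣p∣>0⇒Nonempty {n} {p} ∣p∣>0 with nonempty? p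
... | yes nonempty = nonempty
... | no  empty    = contradiction (sym (trans (cong ∣_∣ (Empty-unique empty)) (∣⊥∣≡0 n))) (ℕ.<⇒≢ ∣p∣>0)

x∈p∧y∈p∧x≢y⇒2≤∣p∣ : x ∈ p → y ∈ p → x ≢ y → 2 ≤ ∣ p ∣
x∈p∧y∈p∧x≢y⇒2≤∣p∣ {p = p} x∈p y∈p x≢y
  rewrite ∣p∣≡1+∣p-x∣ x∈p | ∣p∣≡1+∣p-x∣ (x∈p∧x≢y⇒x∈p-y y∈p (x≢y ∘ sym)) = s≤s (s≤s z≤n)

p⊆q∧∣q∣≤∣p∣⇒p≡q : p ⊆ q → ∣ q ∣ ≤ ∣ p ∣ → p ≡ q
p⊆q∧∣q∣≤∣p∣⇒p≡q {p = p} {q} p⊆q ∣q∣≤∣p∣ = ⊆-antisym p⊆q q⊆p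
  where
  q⊆p : q ⊆ p
  q⊆p {x} x∈q = decidable-stable (x ∈? p) λ x∉p → ℕ.<⇒≱ (p⊂q⇒∣p∣<∣q∣ (p⊆q , x , x∈q , x∉p)) ∣q∣≤∣p∣

∣p∣<∣q∣⇒∃[x∈q∧x∉p] : ∣ p ∣ < ∣ q ∣ → ∃[ x ] (x ∈ q × x ∉ p)
∣p∣<∣q∣⇒∃[x∈q∧x∉p] {p = p} {q} ∣p∣<∣q∣ with any? (λ x → x ∈? q ×-dec ¬? (x ∈? p))
... | yes found = found
... | no  none  = contradiction (p⊆q⇒∣p∣≤∣q∣ q⊆p) (ℕ.<⇒≱ ∣p∣<∣q∣)
  where
  q⊆p : q ⊆ p
  q⊆p {x} x∈q = decidable-stable (x ∈? p) λ x∉p → none (x , x∈q , x∉p)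

p⊆q∧∣q∣≡1+∣p∣⇒q≡p∪⁅x⁆ : p ⊆ q → ∣ q ∣ ≡ suc ∣ p ∣ → ∃[ x ] (x ∉ p × q ≡ p ∪ ⁅ x ⁆)
p⊆q∧∣q∣≡1+∣p∣⇒q≡p∪⁅x⁆ {p = p} {q} p⊆q ∣q∣≡1+∣p∣ with ∣p∣<∣q∣⇒∃[x∈q∧x∉p] (ℕ.≤-reflexive (sym ∣q∣≡1+∣p∣))
... | x , x∈q , x∉p = x , x∉p , sym (p⊆q∧∣q∣≤∣p∣⇒p≡q p∪⁅x⁆⊆q (ℕ.≤-reflexive ∣q∣≡∣p∪⁅x⁆∣))
  where
  ∣q∣≡∣p∪⁅x⁆∣ : ∣ q ∣ ≡ ∣ p ∪ ⁅ x ⁆ ∣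
  ∣q∣≡∣p∪⁅x⁆∣ = trans ∣q∣≡1+∣p∣ (sym (∣p∪⁅x⁆∣≡1+∣p∣ x∉p))
  p∪⁅x⁆⊆q : p ∪ ⁅ x ⁆ ⊆ q
  p∪⁅x⁆⊆q y∈ with x∈p∪q⁻ p ⁅ x ⁆ y∈
  ... | inj₁ y∈p   = p⊆q y∈p
  ... | inj₂ y∈⁅x⁆ = subst (_∈ q) (sym (x∈⁅y⁆⇒x≡y x y∈⁅x⁆)) x∈q

∈Part⁺ : ∀ (part : Fin n → Fin r) {x i} → part x ≡ i → x ∈ Part part i
∈Part⁺ part {zero} refl with part zero ≟ part zero
... | yes _   = here
... | no  ¬eq = contradiction refl ¬eq
∈Part⁺ part {suc x} eq = there (∈Part⁺ (part ∘ suc) eq)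

∈Part⁻ : ∀ (part : Fin n → Fin r) {x i} → x ∈ Part part i → part x ≡ i
∈Part⁻ part {zero} {i} x∈ with part zero ≟ i | x∈
... | yes eq | _ = eq
... | no _   | ()
∈Part⁻ part {suc x} (there x∈) = ∈Part⁻ (part ∘ suc) x∈

-- Counting subsets

count : {P : Pred (Subset n) ℓ} → Decidable P → ℕ
count {n = n} P? = length (filter P? (allSubsets n))

count-cong : {P : Pred (Subset n) ℓ} {Q : Pred (Subset n) ℓ′} (P? : Decidable P) (Q? : Decidable Q) →
             P ≐ Q → count P? ≡ count Q?
count-cong {n = n} P? Q? P≐Q = cong length (filter-≐ P? Q? P≐Q (allSubsets n))

count-none : {P : Pred (Subset n) ℓ} (P? : Decidable P) → (∀ s → ¬ P s) → count P? ≡ 0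
count-none {n = n} P? none = cong length (filter-none P? (All.universal none (allSubsets n)))

count>0⇒∃ : {P : Pred (Subset n) ℓ} (P? : Decidable P) → 0 < count P? → ∃ P
count>0⇒∃ {n = n} P? count>0 with filter P? (allSubsets n) | all-filter P? (allSubsets n)
count>0⇒∃ P? () | [] | []
... | s ∷ _ | Ps ∷ _ = s , Ps

length-filter-map : ∀ {A : Set} {P : Pred (Subset n) ℓ} (P? : Decidable P) (f : A → Subset n) xs →
                    length (filter P? (map f xs)) ≡ length (filter (P? ∘ f) xs)
length-filter-map P? f []       = refl
length-filter-map P? f (x ∷ xs) with does (P? (f x))
... | true  = cong suc (length-filter-map P? f xs)
... | false = length-filter-map P? f xs

count-∷ : {P : Pred (Subset (suc n)) ℓ} (P? : Decidable P) (b : Bool) →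
          count P? ≡ count (P? ∘ (b ∷_)) + count (P? ∘ (not b ∷_))
count-∷ {n = n} P? false = begin
  length (filter P? (map (false ∷_) ss ++ map (true ∷_) ss))
    ≡⟨ cong length (filter-++ P? (map (false ∷_) ss) _) ⟩
  length (filter P? (map (false ∷_) ss) ++ filter P? (map (true ∷_) ss))
    ≡⟨ length-++ (filter P? (map (false ∷_) ss)) ⟩
  length (filter P? (map (false ∷_) ss)) + length (filter P? (map (true ∷_) ss))
    ≡⟨ cong₂ _+_ (length-filter-map P? (false ∷_) ss) (length-filter-map P? (true ∷_) ss) ⟩
  count (P? ∘ (false ∷_)) + count (P? ∘ (true ∷_))
    ∎
  where
  open ≡-Reasoning
  ss : List (Subset n)
  ss = allSubsets n
count-∷ P? true = trans (count-∷ P? false) (ℕ.+-comm (count (P? ∘ (false ∷_))) _)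

infixl 6 _∖_ _∖?_

_∖_ : Pred (Subset n) ℓ → Subset n → Pred (Subset n) ℓ
(P ∖ x) s = P s × s ≢ x

_∖?_ : {P : Pred (Subset n) ℓ} → Decidable P → ∀ x → Decidable (P ∖ x)
(P? ∖? x) s = P? s ×-dec ¬? (≡-dec Bool._≟_ s x)

count-remove : {P : Pred (Subset n) ℓ} (P? : Decidable P) {x : Subset n} → P x →
               count P? ≡ suc (count (P? ∖? x))
count-remove P? {[]} Px
  rewrite filter-accept P? {xs = []} Px
        | filter-reject (P? ∖? []) {xs = []} (λ (_ , []≢[]) → []≢[] refl) = refl
count-remove {P = P} P? {b ∷ x} Px = begin
  count P?
    ≡⟨ count-∷ P? b ⟩
  count (P? ∘ (b ∷_)) + count (P? ∘ (not b ∷_))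
    ≡⟨ cong (_+ count (P? ∘ (not b ∷_))) (count-remove (P? ∘ (b ∷_)) Px) ⟩
  suc (count ((P? ∘ (b ∷_)) ∖? x) + count (P? ∘ (not b ∷_)))
    ≡⟨ cong suc (cong₂ _+_ (count-cong _ _ same) (count-cong _ _ other)) ⟩
  suc (count (Q? ∘ (b ∷_)) + count (Q? ∘ (not b ∷_)))
    ≡⟨ cong suc (count-∷ Q? b) ⟨
  suc (count Q?)
    ∎
  where
  open ≡-Reasoning
  Q? : Decidable (P ∖ (b ∷ x))
  Q? = P? ∖? (b ∷ x)
  same : (λ s → P (b ∷ s) × s ≢ x) ≐ (λ s → P (b ∷ s) × b ∷ s ≢ b ∷ x)
  same = map₂ (λ s≢x → s≢x ∘ ∷-injectiveʳ) , map₂ (λ s≢x → s≢x ∘ cong (b ∷_))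
  other : (λ s → P (not b ∷ s)) ≐ (λ s → P (not b ∷ s) × not b ∷ s ≢ b ∷ x)
  other = (λ Ps → Ps , not-¬ refl ∘ sym ∘ ∷-injectiveˡ) , proj₁

injectiveOn⇒∣g∣≤count : ∀ {m} {P : Pred (Subset m) ℓ} (P? : Decidable P) (f : Fin n → Subset m) (g : Subset n) →
                        (∀ {v} → v ∈ g → P (f v)) → (∀ {v w} → v ∈ g → w ∈ g → f v ≡ f w → v ≡ w) →
                        ∣ g ∣ ≤ count P?
injectiveOn⇒∣g∣≤count P? f g = go _ P? g refl
  where
  go : ∀ k {P : Pred _ ℓ} (P? : Decidable P) g → ∣ g ∣ ≡ k →
       (∀ {v} → v ∈ g → P (f v)) → (∀ {v w} → v ∈ g → w ∈ g → f v ≡ f w → v ≡ w) → k ≤ count P?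
  go zero    P? g _ _ _ = z≤n
  go (suc k) {P} P? g ∣g∣≡1+k into injective with ∣p∣>0⇒Nonempty (subst (0 <_) (sym ∣g∣≡1+k) z<s)
  ... | v , v∈g = begin
    suc k                   ≤⟨ s≤s (go k (P? ∖? f v) (g - v) ∣g-v∣≡k into′ injective′) ⟩
    suc (count (P? ∖? f v)) ≡⟨ count-remove P? (into v∈g) ⟨
    count P?                ∎
    where
    open ℕ.≤-Reasoning
    ⊆g : g - v ⊆ g
    ⊆g = p─q⊆p g ⁅ v ⁆
    ∣g-v∣≡k : ∣ g - v ∣ ≡ k
    ∣g-v∣≡k = ℕ.suc-injective (trans (sym (∣p∣≡1+∣p-x∣ v∈g)) ∣g∣≡1+k)
    into′ : ∀ {w} → w ∈ g - v → (P ∖ f v) (f w)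
    into′ w∈ = into (⊆g w∈) , λ fw≡fv → x∉p-x g v (subst (_∈ g - v) (injective (⊆g w∈) v∈g fw≡fv) w∈)
    injective′ : ∀ {w w′} → w ∈ g - v → w′ ∈ g - v → f w ≡ f w′ → w ≡ w′
    injective′ w∈ w′∈ = injective (⊆g w∈) (⊆g w′∈)

Matched : Rel (Subset n) ℓ → Pred (Subset n) ℓ′ → Set _
Matched _~_ P = ∀ {x} → P x → ∃[ y ] (x ~ y × P y)

module _ {_~_ : Rel (Subset n) ℓ}
         (~-sym : Symmetric _~_)
         (~-functional : ∀ {x y z} → x ~ y → x ~ z → y ≡ z)
         (~-irrefl : ∀ {x y} → x ~ y → x ≢ y)
         where

  private
    removePair : {P : Pred (Subset n) ℓ′} (P? : Decidable P) → Matched _~_ P → 0 < count P? →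
                 ∃₂ λ x y → count P? ≡ 2 + count (P? ∖? x ∖? y) × Matched _~_ (P ∖ x ∖ y)
    removePair {P = P} P? matched count>0 with count>0⇒∃ P? count>0
    ... | x , Px with matched Px
    ... | y , x~y , Py = x , y , count≡ , matched′
      where
      count≡ : count P? ≡ 2 + count (P? ∖? x ∖? y)
      count≡ = trans (count-remove P? Px) (cong suc (count-remove (P? ∖? x) (Py , ~-irrefl x~y ∘ sym)))
      matched′ : Matched _~_ (P ∖ x ∖ y)
      matched′ ((Pz , z≢x) , z≢y) with matched Pz
      ... | z′ , z~z′ , Pz′ = z′ , z~z′ , (Pz′ , z′≢x) , z′≢y
        where
        z′≢x : z′ ≢ x
        z′≢x z′≡x = z≢y (~-functional (subst (_~ _) z′≡x (~-sym z~z′)) x~y)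
        z′≢y : z′ ≢ y
        z′≢y z′≡y = z≢x (~-functional (subst (_~ _) z′≡y (~-sym z~z′)) (~-sym x~y))

  matched⇒2∣count : {P : Pred (Subset n) ℓ′} (P? : Decidable P) → Matched _~_ P → 2 ∣ count P?
  matched⇒2∣count P? = go _ P? refl
    where
    go : ∀ m {P : Pred (Subset n) ℓ′} (P? : Decidable P) → count P? ≡ m → Matched _~_ P → 2 ∣ m
    go zero _ _ _ = 2 ∣0
    go (suc m) P? count≡ matched with removePair P? matched (subst (0 <_) (sym count≡) z<s)
    go (suc zero)    P? count≡ matched | _ , _ , count≡2+ , _ with () ← trans (sym count≡) count≡2+
    go (suc (suc m)) P? count≡ matched | x , y , count≡2+ , matched′ =
      ∣m∣n⇒∣m+n ∣-refl (go m (P? ∖? x ∖? y) count′≡m matched′)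
      where
      count′≡m : count (P? ∖? x ∖? y) ≡ m
      count′≡m = ℕ.suc-injective (ℕ.suc-injective (trans (sym count≡2+) count≡))

-- Profiles

profile : (Fin n → Fin r) → Subset n → Fin r → ℕ
profile part s i = ∣ s ∩ Part part i ∣

hasProfile? : (part : Fin n → Fin r) (c : Fin r → ℕ) → Decidable (λ s → profile part s ≗ c)
hasProfile? part c s = all? λ i → profile part s i ℕ.≟ c i

profile-⁅x⁆-own : ∀ (part : Fin n → Fin r) x → profile part ⁅ x ⁆ (part x) ≡ 1
profile-⁅x⁆-own part x = ∣⁅x⁆∩A∣≡1 {x = x} (∈Part⁺ part refl)

profile-⁅x⁆-other : ∀ (part : Fin n → Fin r) {x i} → part x ≢ i → profile part ⁅ x ⁆ i ≡ 0
profile-⁅x⁆-other part {x} px≢i = ∣⁅x⁆∩A∣≡0 {x = x} (px≢i ∘ ∈Part⁻ part)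

profile-⁅⁆-cong : ∀ (part : Fin n → Fin r) {x y} → part x ≡ part y → profile part ⁅ x ⁆ ≗ profile part ⁅ y ⁆
profile-⁅⁆-cong part {x} {y} px≡py i with part y ≟ i
... | yes refl = trans (subst (λ j → profile part ⁅ x ⁆ j ≡ 1) px≡py (profile-⁅x⁆-own part x))
                       (sym (profile-⁅x⁆-own part y))
... | no py≢i  = trans (profile-⁅x⁆-other part (py≢i ∘ trans (sym px≡py))) (sym (profile-⁅x⁆-other part py≢i))

-- For part : Fin (suc n) → Fin r, Part part i computes to isYes (part zero ≟ i) ∷ Part (part ∘ suc) i.

∣isYes[a≟a]∷t∣ : ∀ (a : Fin r) (t : Subset n) → ∣ isYes (a ≟ a) ∷ t ∣ ≡ suc ∣ t ∣
∣isYes[a≟a]∷t∣ a t with a ≟ a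
... | yes _   = refl
... | no a≢a = contradiction refl a≢a

∣isYes[a≟i]∷t∣ : ∀ {a i : Fin r} (t : Subset n) → a ≢ i → ∣ isYes (a ≟ i) ∷ t ∣ ≡ ∣ t ∣
∣isYes[a≟i]∷t∣ {a = a} {i} t a≢i with a ≟ i
... | yes a≡i = contradiction a≡i a≢i
... | no _    = refl

sum-const : ∀ r c → ∑[ i < r ] c ≡ r * c
sum-const zero    c = refl
sum-const (suc r) c = cong (c +_) (sum-const r c)

sum-mono-≤ : ∀ {f g : Fin r → ℕ} → (∀ i → f i ≤ g i) → sum f ≤ sum g
sum-mono-≤ {zero}  f≤g = z≤n
sum-mono-≤ {suc r} f≤g = ℕ.+-mono-≤ (f≤g zero) (sum-mono-≤ (f≤g ∘ suc))

∑∣isYes∷∣ : ∀ (a : Fin (suc r)) (t : Fin (suc r) → Subset n) →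
            ∑[ i < suc r ] ∣ isYes (a ≟ i) ∷ t i ∣ ≡ suc (∑[ i < suc r ] ∣ t i ∣)
∑∣isYes∷∣ a t = begin
  sum (λ i → ∣ isYes (a ≟ i) ∷ t i ∣)
    ≡⟨ sum-remove {i = a} (λ i → ∣ isYes (a ≟ i) ∷ t i ∣) ⟩
  ∣ isYes (a ≟ a) ∷ t a ∣ + sum (removeAt (λ i → ∣ isYes (a ≟ i) ∷ t i ∣) a)
    ≡⟨ cong₂ _+_ (∣isYes[a≟a]∷t∣ a (t a))
                 (sum-cong-≗ λ j → ∣isYes[a≟i]∷t∣ (t (punchIn a j)) (punchInᵢ≢i a j ∘ sym)) ⟩
  suc (∣ t a ∣ + sum (removeAt (λ i → ∣ t i ∣) a))
    ≡⟨ cong suc (sum-remove {i = a} (λ i → ∣ t i ∣)) ⟨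
  suc (sum (λ i → ∣ t i ∣))
    ∎
  where open ≡-Reasoning

∑-profile : ∀ (part : Fin n → Fin r) (s : Subset n) → ∑[ i < r ] profile part s i ≡ ∣ s ∣
∑-profile {r = r}     part []            = sum-replicate-zero r
∑-profile             part (outside ∷ s) = ∑-profile (part ∘ suc) s
∑-profile {r = zero}  part (inside  ∷ s) = contradiction (part zero) λ ()
∑-profile {r = suc r} part (inside  ∷ s) =
  trans (∑∣isYes∷∣ (part zero) (λ i → s ∩ Part (part ∘ suc) i)) (cong suc (∑-profile (part ∘ suc) s))

∑∣Part∣≡n : ∀ (part : Fin n → Fin r) → ∑[ i < r ] ∣ Part part i ∣ ≡ n
∑∣Part∣≡n {n} part = trans (sum-cong-≗ λ i → cong ∣_∣ (sym (∩-identityˡ (Part part i))))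
                           (trans (∑-profile part ⊤) (∣⊤∣≡n n))

product-zero : ∀ (f : Fin r → ℕ) a → f a ≡ 0 → product f ≡ 0
product-zero {suc r} f a fa≡0 = trans (product-remove {i = a} f) (cong (_* product (removeAt f a)) fa≡0)

product-+ : ∀ (a : Fin (suc r)) {f g h : Fin (suc r) → ℕ} → f a + g a ≡ h a →
            (∀ {i} → a ≢ i → f i ≡ h i) → (∀ {i} → a ≢ i → g i ≡ h i) →
            product f + product g ≡ product h
product-+ a {f} {g} {h} fa+ga≡ha f≡h g≡h = begin
  product f + product g
    ≡⟨ cong₂ _+_ (product-remove {i = a} f) (product-remove {i = a} g) ⟩
  f a * product (removeAt f a) + g a * product (removeAt g a)
    ≡⟨ cong₂ (λ x y → f a * x + g a * y) (awayFrom-a f≡h) (awayFrom-a g≡h) ⟩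
  f a * H + g a * H ≡⟨ ℕ.*-distribʳ-+ H (f a) (g a) ⟨
  (f a + g a) * H   ≡⟨ cong (_* H) fa+ga≡ha ⟩
  h a * H           ≡⟨ product-remove {i = a} h ⟨
  product h         ∎
  where
  open ≡-Reasoning
  H : ℕ
  H = product (removeAt h a)
  awayFrom-a : ∀ {f} → (∀ {i} → a ≢ i → f i ≡ h i) → product (removeAt f a) ≡ H
  awayFrom-a f≡h = product-cong λ j → f≡h (punchInᵢ≢i a j ∘ sym)

product-odd : ∀ (f : Fin r → ℕ) → (∀ i → ¬ 2 ∣ f i) → ¬ 2 ∣ product f
product-odd {zero}  f _   2∣1 = contradiction (∣1⇒≡1 2∣1) λ ()
product-odd {suc r} f odd 2∣∏ with euclidsLemma (f zero) (product (f ∘ suc)) prime[2] 2∣∏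
... | inj₁ 2∣f₀ = odd zero 2∣f₀
... | inj₂ 2∣∏′ = product-odd (f ∘ suc) (odd ∘ suc) 2∣∏′

count-profile₀ : ∀ (part : Fin 0 → Fin r) (c : Fin r → ℕ) →
                 count (hasProfile? part c) ≡ product (λ i → 0 C c i)
count-profile₀ {r} part c with hasProfile? part c []
... | yes 0≗c = begin
  length (filter (hasProfile? part c) ([] ∷ []))
    ≡⟨ cong length (filter-accept (hasProfile? part c) {xs = []} 0≗c) ⟩
  1
    ≡⟨ product-replicate-one r ⟨
  product {r} (λ _ → 1)
    ≡⟨ product-cong (λ i → cong (0 C_) (0≗c i)) ⟩
  product (λ i → 0 C c i)
    ∎
  where open ≡-Reasoning
... | no ¬0≗c with i , 0≢cᵢ ← ¬∀⟶∃¬ r (λ i → 0 ≡ c i) (λ i → 0 ℕ.≟ c i) ¬0≗c = begin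
  length (filter (hasProfile? part c) ([] ∷ []))
    ≡⟨ cong length (filter-reject (hasProfile? part c) {xs = []} ¬0≗c) ⟩
  0
    ≡⟨ product-zero _ i (0C[k]≡0 (c i) 0≢cᵢ) ⟨
  product (λ i → 0 C c i)
    ∎
  where
  open ≡-Reasoning
  0C[k]≡0 : ∀ k → 0 ≢ k → 0 C k ≡ 0
  0C[k]≡0 zero    0≢0 = contradiction refl 0≢0
  0C[k]≡0 (suc k) _   = refl

private
  module ProfileStep (part : Fin (suc n) → Fin r) (c : Fin r → ℕ) where
    a : Fin r
    a = part zero
    part′ : Fin n → Fin r
    part′ = part ∘ suc
    V′ : Fin r → Subset n
    V′ = Part part′
    c′ : Fin r → ℕ
    c′ = updateAt c a pred

    c′ₐ≡d : ∀ {d} → c a ≡ suc d → c′ a ≡ d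
    c′ₐ≡d cₐ≡1+d = trans (updateAt-updates a c) (cong pred cₐ≡1+d)

    c′≡c : ∀ {i} → a ≢ i → c′ i ≡ c i
    c′≡c a≢i = updateAt-minimal _ a c (a≢i ∘ sym)

    splitFirst : count (hasProfile? part c) ≡
                 count (hasProfile? part′ c) + count (hasProfile? part c ∘ (inside ∷_))
    splitFirst = count-∷ (hasProfile? part c) false

    noneInside : c a ≡ 0 → ∀ s → ¬ (profile part (inside ∷ s) ≗ c)
    noneInside cₐ≡0 s same = ℕ.1+n≢0 (trans (sym (∣isYes[a≟a]∷t∣ a (s ∩ V′ a))) (trans (same a) cₐ≡0))

    unchanged : c a ≡ 0 → ∀ i → ∣ V′ i ∣ C c i ≡ ∣ Part part i ∣ C c i
    unchanged cₐ≡0 i with a ≟ i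
    ... | yes refl rewrite cₐ≡0 = refl
    ... | no  _    = refl

    inside≐ : ∀ {d} → c a ≡ suc d → (λ s → profile part (inside ∷ s) ≗ c) ≐ (λ s → profile part′ s ≗ c′)
    inside≐ cₐ≡1+d = (λ {s} same i → to {s} (same i)) , (λ {s} same i → from {s} (same i))
      where
      to : ∀ {s i} → profile part (inside ∷ s) i ≡ c i → profile part′ s i ≡ c′ i
      to {s} {i} eq with a ≟ i
      ... | yes refl = trans (ℕ.suc-injective (trans eq cₐ≡1+d)) (sym (c′ₐ≡d cₐ≡1+d))
      ... | no a≢i  = trans eq (sym (c′≡c a≢i))
      from : ∀ {s i} → profile part′ s i ≡ c′ i → profile part (inside ∷ s) i ≡ c i
      from {s} {i} eq with a ≟ i
      ... | yes refl = trans (cong suc (trans eq (c′ₐ≡d cₐ≡1+d))) (sym cₐ≡1+d)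
      ... | no a≢i  = trans eq (c′≡c a≢i)

    pascal : ∀ {d} → c a ≡ suc d → ∣ V′ a ∣ C c a + ∣ V′ a ∣ C c′ a ≡ ∣ Part part a ∣ C c a
    pascal {d} cₐ≡1+d = begin
      ∣ V′ a ∣ C c a + ∣ V′ a ∣ C c′ a ≡⟨ cong₂ (λ k k′ → ∣ V′ a ∣ C k + ∣ V′ a ∣ C k′) cₐ≡1+d (c′ₐ≡d cₐ≡1+d) ⟩
      ∣ V′ a ∣ C suc d + ∣ V′ a ∣ C d  ≡⟨ ℕ.+-comm (∣ V′ a ∣ C suc d) _ ⟩
      ∣ V′ a ∣ C d + ∣ V′ a ∣ C suc d  ≡⟨ nCk+nC[k+1]≡[n+1]C[k+1] ∣ V′ a ∣ d ⟩
      suc ∣ V′ a ∣ C suc d             ≡⟨ cong₂ _C_ (∣isYes[a≟a]∷t∣ a (V′ a)) cₐ≡1+d ⟨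
      ∣ Part part a ∣ C c a            ∎
      where open ≡-Reasoning

    away : ∀ {i} → a ≢ i → ∣ V′ i ∣ C c i ≡ ∣ Part part i ∣ C c i
    away {i} a≢i = cong (_C c i) (sym (∣isYes[a≟i]∷t∣ (V′ i) a≢i))

    away′ : ∀ {i} → a ≢ i → ∣ V′ i ∣ C c′ i ≡ ∣ Part part i ∣ C c i
    away′ {i} a≢i = trans (cong (∣ V′ i ∣ C_) (c′≡c a≢i)) (away a≢i)

count-profile : ∀ (part : Fin n → Fin r) (c : Fin r → ℕ) →
                count (hasProfile? part c) ≡ product (λ i → ∣ Part part i ∣ C c i)
count-profile {zero}          part c = count-profile₀ part c
count-profile {suc n} {zero}  part c = contradiction (part zero) λ ()
count-profile {suc n} {suc r} part c with c (part zero) in cₐ≡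
... | zero = begin
  count (hasProfile? part c)
    ≡⟨ splitFirst ⟩
  count (hasProfile? part′ c) + count (hasProfile? part c ∘ (inside ∷_))
    ≡⟨ cong₂ _+_ (count-profile part′ c) (count-none _ (noneInside cₐ≡)) ⟩
  product (λ i → ∣ V′ i ∣ C c i) + 0
    ≡⟨ ℕ.+-identityʳ _ ⟩
  product (λ i → ∣ V′ i ∣ C c i)
    ≡⟨ product-cong (unchanged cₐ≡) ⟩
  product (λ i → ∣ Part part i ∣ C c i)
    ∎
  where
  open ≡-Reasoning
  open ProfileStep part c
... | suc d = begin
  count (hasProfile? part c)
    ≡⟨ splitFirst ⟩
  count (hasProfile? part′ c) + count (hasProfile? part c ∘ (inside ∷_))
    ≡⟨ cong₂ _+_ (count-profile part′ c) (trans (count-cong _ _ (inside≐ cₐ≡)) (count-profile part′ c′)) ⟩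
  product (λ i → ∣ V′ i ∣ C c i) + product (λ i → ∣ V′ i ∣ C c′ i)
    ≡⟨ product-+ a (pascal cₐ≡) away away′ ⟩
  product (λ i → ∣ Part part i ∣ C c i)
    ∎
  where
  open ≡-Reasoning
  open ProfileStep part c

-- The codegree bound

balanced⇒r*∣Part∣≤n+2r : ∀ (part : Fin n → Fin r) → (∀ i j → ∣ Part part i ∣ ≤ ∣ Part part j ∣ + 2) →
                         ∀ j → r * ∣ Part part j ∣ ≤ n + r * 2
balanced⇒r*∣Part∣≤n+2r {n} {r} part balanced j = begin
  r * ∣ Part part j ∣                       ≡⟨ sum-const r _ ⟨
  ∑[ i < r ] ∣ Part part j ∣                ≤⟨ sum-mono-≤ (balanced j) ⟩
  ∑[ i < r ] (∣ Part part i ∣ + 2)          ≡⟨ ∑-distrib-+ (λ i → ∣ Part part i ∣) (λ _ → 2) ⟩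
  ∑[ i < r ] ∣ Part part i ∣ + ∑[ i < r ] 2 ≡⟨ cong₂ _+_ (∑∣Part∣≡n part) (sum-const r 2) ⟩
  n + r * 2                                 ∎
  where open ℕ.≤-Reasoning

codegree-arithmetic : ∀ k n d m → n ≤ k + m + d → suc k * m ≤ n + suc k * 2 → k * n ≤ suc k * (d + suc (suc k))
codegree-arithmetic k n d m n≤k+m+d balanced = ℕ.+-cancelˡ-≤ n _ _ (begin
  suc k * n                       ≤⟨ ℕ.*-monoʳ-≤ (suc k) n≤k+m+d ⟩
  suc k * (k + m + d)             ≡⟨ regroup k m d ⟩
  suc k * m + suc k * (k + d)     ≤⟨ ℕ.+-monoˡ-≤ (suc k * (k + d)) balanced ⟩
  n + suc k * 2 + suc k * (k + d) ≡⟨ collect n k d ⟩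
  n + suc k * (d + suc (suc k))   ∎)
  where
  open ℕ.≤-Reasoning
  regroup : ∀ k m d → suc k * (k + m + d) ≡ suc k * m + suc k * (k + d)
  regroup = solve-∀
  collect : ∀ n k d → n + suc k * 2 + suc k * (k + d) ≡ n + suc k * (d + suc (suc k))
  collect = solve-∀

module _ {k} (part : Fin n → Fin (suc k)) where

  private
    H : Hypergraph n
    H = Hconstr (suc k) part

  avoidablePart : ∀ p → ∃[ j ] (∀ {v} → v ∉ p → part v ≢ j → ¬ Transversal part (p ∪ ⁅ v ⁆))
  avoidablePart p with any? (λ v → ¬? (v ∈? p) ×-dec transversal? part (p ∪ ⁅ v ⁆))
  ... | no ∄v = zero , λ v∉p _ T → ∄v (_ , v∉p , T)
  ... | yes (v₀ , v₀∉p , T₀) = part v₀ , λ v∉p pv≢j T → ℕ.0≢1+n (trans (sym misses) (hits v∉p pv≢j T))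
    where
    j : Fin (suc k)
    j = part v₀
    misses : profile part p j ≡ 0
    misses = ℕ.suc-injective (begin
      1 + profile part p j                     ≡⟨ cong (_+ profile part p j) (profile-⁅x⁆-own part v₀) ⟨
      profile part ⁅ v₀ ⁆ j + profile part p j ≡⟨ ∣p∪⁅x⁆∩A∣≡∣⁅x⁆∩A∣+∣p∩A∣ v₀∉p ⟨
      profile part (p ∪ ⁅ v₀ ⁆) j              ≡⟨ T₀ j ⟩
      1                                        ∎)
      where open ≡-Reasoning
    hits : ∀ {v} → v ∉ p → part v ≢ j → Transversal part (p ∪ ⁅ v ⁆) → profile part p j ≡ 1
    hits {v} v∉p pv≢j T = begin
      profile part p j                        ≡⟨ cong (_+ profile part p j) (profile-⁅x⁆-other part pv≢j) ⟨
      profile part ⁅ v ⁆ j + profile part p j ≡⟨ ∣p∪⁅x⁆∩A∣≡∣⁅x⁆∩A∣+∣p∩A∣ v∉p ⟨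
      profile part (p ∪ ⁅ v ⁆) j              ≡⟨ T j ⟩
      1                                       ∎
      where open ≡-Reasoning

  ∣∁[p∪Part]∣≤degree : ∀ {p j} → ∣ p ∣ ≡ k → (∀ {v} → v ∉ p → part v ≢ j → ¬ Transversal part (p ∪ ⁅ v ⁆)) →
                       ∣ ∁ (p ∪ Part part j) ∣ ≤ degree H p
  ∣∁[p∪Part]∣≤degree {p} {j} ∣p∣≡k avoid =
    injectiveOn⇒∣g∣≤count (λ e → edge? H e ×-dec (p ⊆? e)) (λ v → p ∪ ⁅ v ⁆) (∁ (p ∪ Part part j))
                          extends (λ v∈ _ → p∪⁅x⁆≡p∪⁅y⁆⇒x≡y (proj₁ (avoided v∈)))
    where
    avoided : ∀ {v} → v ∈ ∁ (p ∪ Part part j) → v ∉ p × part v ≢ j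
    avoided {v} v∈ = v∉p∪Vⱼ ∘ x∈p∪q⁺ ∘ inj₁ , v∉p∪Vⱼ ∘ x∈p∪q⁺ ∘ inj₂ ∘ ∈Part⁺ part
      where
      v∉p∪Vⱼ : v ∉ p ∪ Part part j
      v∉p∪Vⱼ = x∈∁p⇒x∉p v∈
    extends : ∀ {v} → v ∈ ∁ (p ∪ Part part j) → Edge H (p ∪ ⁅ v ⁆) × p ⊆ p ∪ ⁅ v ⁆
    extends {v} v∈ with v∉p , pv≢j ← avoided v∈ =
      (trans (∣p∪⁅x⁆∣≡1+∣p∣ v∉p) (cong suc ∣p∣≡k) , avoid v∉p pv≢j) , p⊆p∪q ⁅ v ⁆

  codegreeBound : (∀ i j → ∣ Part part i ∣ ≤ ∣ Part part j ∣ + 2) → MinCodegreeBound (suc k) H (suc (suc k))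
  codegreeBound balanced p ∣p∣≡k with j , avoid ← avoidablePart p =
    codegree-arithmetic k n (degree H p) ∣ Part part j ∣ n≤ (balanced⇒r*∣Part∣≤n+2r part balanced j)
    where
    n≤ : n ≤ k + ∣ Part part j ∣ + degree H p
    n≤ = begin
      n                                                 ≤⟨ n≤∣p∣+∣q∣+∣∁[p∪q]∣ p (Part part j) ⟩
      ∣ p ∣ + ∣ Part part j ∣ + ∣ ∁ (p ∪ Part part j) ∣ ≤⟨ ℕ.+-mono-≤ (ℕ.≤-reflexive (cong (_+ _) ∣p∣≡k))
                                                                      (∣∁[p∪Part]∣≤degree ∣p∣≡k avoid) ⟩
      k + ∣ Part part j ∣ + degree H p                  ∎
      where open ℕ.≤-Reasoning

-- Near-transversals

module _ {k} (part : Fin n → Fin (suc k)) where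

  private
    H : Hypergraph n
    H = Hconstr (suc k) part

  -- V_r of the paper is the part fromℕ k; the hypothesis 2 + toℕ i ≤ r singles out the others.
  onesButLast : Fin (suc k) → ℕ
  onesButLast i = if isYes (i ≟ fromℕ k) then 0 else 1

  onesButLast-last : onesButLast (fromℕ k) ≡ 0
  onesButLast-last with fromℕ k ≟ fromℕ k
  ... | yes _  = refl
  ... | no ¬eq = contradiction refl ¬eq

  onesButLast-other : ∀ {i} → i ≢ fromℕ k → onesButLast i ≡ 1
  onesButLast-other {i} i≢last with i ≟ fromℕ k
  ... | yes i≡last = contradiction i≡last i≢last
  ... | no _       = refl

  ∑onesButLast≡k : sum onesButLast ≡ k
  ∑onesButLast≡k = begin
    sum onesButLast
      ≡⟨ sum-init-last onesButLast ⟩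
    sum (onesButLast ∘ inject₁) + onesButLast (fromℕ k)
      ≡⟨ cong₂ _+_ (sum-cong-≗ λ i → onesButLast-other {inject₁ i} (fromℕ≢inject₁ ∘ sym)) onesButLast-last ⟩
    sum {k} (λ _ → 1) + 0 ≡⟨ cong (_+ 0) (sum-const k 1) ⟩
    k * 1 + 0             ≡⟨ ℕ.+-identityʳ (k * 1) ⟩
    k * 1                 ≡⟨ ℕ.*-identityʳ k ⟩
    k                     ∎
    where open ≡-Reasoning

  NearTransversal : Subset n → Set
  NearTransversal p = profile part p ≗ onesButLast

  ∣NearTransversal∣≡k : ∀ {p} → NearTransversal p → ∣ p ∣ ≡ k
  ∣NearTransversal∣≡k {p} NTp =
    trans (sym (∑-profile part p)) (trans (sum-cong-≗ {x = profile part p} NTp) ∑onesButLast≡k)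

  extendingVertex : ∀ {p e} → NearTransversal p → Edge H e → p ⊆ e →
                    ∃[ v ] (v ∉ p × e ≡ p ∪ ⁅ v ⁆ × part v ≢ fromℕ k)
  extendingVertex {p} NTp (∣e∣≡1+k , ¬T) p⊆e
    with v , v∉p , e≡p∪⁅v⁆ ← p⊆q∧∣q∣≡1+∣p∣⇒q≡p∪⁅x⁆ p⊆e (trans ∣e∣≡1+k (cong suc (sym (∣NearTransversal∣≡k {p} NTp)))) =
    v , v∉p , e≡p∪⁅v⁆ , λ pv≡last → ¬T (subst (Transversal part) (sym e≡p∪⁅v⁆) (transversal pv≡last))
    where
    transversal : part v ≡ fromℕ k → Transversal part (p ∪ ⁅ v ⁆)
    transversal pv≡last i = trans (∣p∪⁅x⁆∩A∣≡∣⁅x⁆∩A∣+∣p∩A∣ {p = p} v∉p) (ones i)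
      where
      ones : ∀ i → profile part ⁅ v ⁆ i + profile part p i ≡ 1
      ones i with i ≟ fromℕ k
      ... | yes refl  = cong₂ _+_ (subst (λ j → profile part ⁅ v ⁆ j ≡ 1) pv≡last (profile-⁅x⁆-own part v))
                                  (trans (NTp (fromℕ k)) onesButLast-last)
      ... | no i≢last = cong₂ _+_ (profile-⁅x⁆-other part λ pv≡i → i≢last (trans (sym pv≡i) pv≡last))
                                  (trans (NTp i) (onesButLast-other i≢last))

  OtherNearTransversalIn : Subset n → Subset n → Subset n → Set
  OtherNearTransversalIn e p q = NearTransversal q × q ⊆ e × q ≢ p

  module _ {p v u} (NTp : NearTransversal p) (v∉p : v ∉ p) (pv≢last : part v ≢ fromℕ k)
                   (u∈p : u ∈ p) (pu≡pv : part u ≡ part v) where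

    private
      e : Subset n
      e = p ∪ ⁅ v ⁆
      u∈e : u ∈ e
      u∈e = x∈p∪q⁺ (inj₁ u∈p)
      ∣p∣≡k : ∣ p ∣ ≡ k
      ∣p∣≡k = ∣NearTransversal∣≡k {p} NTp
      u≢v : u ≢ v
      u≢v u≡v = v∉p (subst (_∈ p) u≡v u∈p)

    partner-other : OtherNearTransversalIn e p (e - u)
    partner-other = NTq , p─q⊆p e ⁅ u ⁆ , λ q≡p → v∉p (subst (v ∈_) q≡p v∈q)
      where
      v∈q : v ∈ e - u
      v∈q = x∈p∧x≢y⇒x∈p-y (x∈p∪⁅x⁆ p v) (u≢v ∘ sym)
      NTq : NearTransversal (e - u)
      NTq i = ℕ.+-cancelˡ-≡ (profile part ⁅ v ⁆ i) _ _ (begin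
        profile part ⁅ v ⁆ i + profile part (e - u) i
          ≡⟨ cong (_+ profile part (e - u) i) (profile-⁅⁆-cong part pu≡pv i) ⟨
        profile part ⁅ u ⁆ i + profile part (e - u) i
          ≡⟨ ∣p∩A∣≡∣⁅x⁆∩A∣+∣p-x∩A∣ u∈e ⟨
        profile part e i
          ≡⟨ ∣p∪⁅x⁆∩A∣≡∣⁅x⁆∩A∣+∣p∩A∣ {p = p} v∉p ⟩
        profile part ⁅ v ⁆ i + profile part p i
          ≡⟨ cong (profile part ⁅ v ⁆ i +_) (NTp i) ⟩
        profile part ⁅ v ⁆ i + onesButLast i
          ∎)
        where open ≡-Reasoning

    -- A near-transversal q ⊆ e other than p contains v (else q = p), hence not u (the part
    -- of v would meet q twice), so q ⊆ e - u, and both have k elements.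
    partner-unique : ∀ {q} → OtherNearTransversalIn e p q → q ≡ e - u
    partner-unique {q} (NTq , q⊆e , q≢p) = p⊆q∧∣q∣≤∣p∣⇒p≡q q⊆e-u (ℕ.≤-reflexive (trans ∣e-u∣≡k (sym ∣q∣≡k)))
      where
      ∣q∣≡k : ∣ q ∣ ≡ k
      ∣q∣≡k = ∣NearTransversal∣≡k {q} NTq
      ∣e-u∣≡k : ∣ e - u ∣ ≡ k
      ∣e-u∣≡k = ℕ.suc-injective (trans (sym (∣p∣≡1+∣p-x∣ u∈e)) (trans (∣p∪⁅x⁆∣≡1+∣p∣ v∉p) (cong suc ∣p∣≡k)))
      v∈q : v ∈ q
      v∈q = decidable-stable (v ∈? q) λ v∉q →
        q≢p (p⊆q∧∣q∣≤∣p∣⇒p≡q (q⊆p∪⁅x⁆∧x∉q⇒q⊆p q⊆e v∉q) (ℕ.≤-reflexive (trans ∣p∣≡k (sym ∣q∣≡k))))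
      u∉q : u ∉ q
      u∉q u∈q = ℕ.<⇒≱ (subst (_< 2) (sym (trans (NTq (part v)) (onesButLast-other pv≢last))) ℕ.≤-refl)
                      (x∈p∧y∈p∧x≢y⇒2≤∣p∣ (x∈p∩q⁺ (u∈q , ∈Part⁺ part pu≡pv)) (x∈p∩q⁺ (v∈q , ∈Part⁺ part refl)) u≢v)
      q⊆e-u : q ⊆ e - u
      q⊆e-u x∈q = x∈p∧x≢y⇒x∈p-y (q⊆e x∈q) λ x≡u → u∉q (subst (_∈ q) x≡u x∈q)

  uniqueOther : ∀ {p e} → NearTransversal p → Edge H e → p ⊆ e →
                ∃[ q ] (OtherNearTransversalIn e p q × ∀ {q′} → OtherNearTransversalIn e p q′ → q′ ≡ q)
  uniqueOther {p} NTp e∈H p⊆e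
    with v , v∉p , refl , pv≢last ← extendingVertex NTp e∈H p⊆e
    with u , u∈p∩V ← ∣p∣>0⇒Nonempty (subst (0 <_) (sym (trans (NTp (part v)) (onesButLast-other pv≢last))) z<s)
    with u∈p , u∈V ← x∈p∩q⁻ p (Part part (part v)) u∈p∩V
    = _ , partner-other NTp v∉p pv≢last u∈p pu≡pv , partner-unique NTp v∉p pv≢last u∈p pu≡pv
    where
    pu≡pv : part u ≡ part v
    pu≡pv = ∈Part⁻ part u∈V

  noSteinerSystem : (∀ i → 2 + toℕ i ≤ suc k → ¬ 2 ∣ ∣ Part part i ∣) → ¬ ContainsSteinerSystem (suc k) H
  noSteinerSystem odd (S , S⊆H , steiner) =
    product-odd _ oddFactor (subst (2 ∣_) (count-profile part onesButLast)
      (matched⇒2∣count ~-sym ~-functional ~-irrefl (hasProfile? part onesButLast) matched))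
    where
    _~_ : Rel (Subset n) 0ℓ
    p ~ q = NearTransversal p × NearTransversal q × p ≢ q × ∃[ e ] (S e × p ⊆ e × q ⊆ e)

    ~-sym : ∀ {p q} → p ~ q → q ~ p
    ~-sym (NTp , NTq , p≢q , e , Se , p⊆e , q⊆e) = NTq , NTp , p≢q ∘ sym , e , Se , q⊆e , p⊆e

    ~-irrefl : ∀ {p q} → p ~ q → p ≢ q
    ~-irrefl (_ , _ , p≢q , _) = p≢q

    ~-functional : ∀ {p q q′} → p ~ q → p ~ q′ → q ≡ q′
    ~-functional {p} (NTp , NTq , p≢q , e , Se , p⊆e , q⊆e) (_ , NTq′ , p≢q′ , e′ , Se′ , p⊆e′ , q′⊆e′)
      with _ , _ , _ , onlyEdge ← steiner p (∣NearTransversal∣≡k {p} NTp)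
      with refl ← onlyEdge e Se p⊆e | refl ← onlyEdge e′ Se′ p⊆e′
      with _ , _ , onlyOther ← uniqueOther NTp (S⊆H e Se) p⊆e
      = trans (onlyOther (NTq , q⊆e , p≢q ∘ sym)) (sym (onlyOther (NTq′ , q′⊆e′ , p≢q′ ∘ sym)))

    matched : Matched _~_ NearTransversal
    matched {p} NTp
      with e , Se , p⊆e , _ ← steiner p (∣NearTransversal∣≡k {p} NTp)
      with q , (NTq , q⊆e , q≢p) , _ ← uniqueOther NTp (S⊆H e Se) p⊆e
      = q , (NTp , NTq , q≢p ∘ sym , e , Se , p⊆e , q⊆e) , NTq

    oddFactor : ∀ i → ¬ 2 ∣ ∣ Part part i ∣ C onesButLast i
    oddFactor i with i ≟ fromℕ k
    ... | yes _     = λ 2∣1 → contradiction (∣1⇒≡1 2∣1) λ ()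
    ... | no i≢last = subst (¬_ ∘ (2 ∣_)) (sym (nC1≡n ∣ Part part i ∣)) (odd i (s≤s toℕi<k))
      where
      toℕi<k : toℕ i < k
      toℕi<k = ℕ.≤∧≢⇒< (toℕ≤pred[n] i) (i≢last ∘ toℕ-injective ∘ flip trans (sym (toℕ-fromℕ k)))

proposition5p4 : (r : ℕ) → 2 ≤ r →
    Σ ℕ λ C →
      (n : ℕ) → r ≤ n → (part : Fin n → Fin r) →
      (∀ i j → ∣ Part part i ∣ ≤ ∣ Part part j ∣ + 2) →
      (∀ i → 2 + toℕ i ≤ r → ¬ (2 ∣ ∣ Part part i ∣)) →
      MinCodegreeBound r (Hconstr r part) C ×
      ¬ ContainsSteinerSystem r (Hconstr r part)
proposition5p4 (suc k) _ =
  suc (suc k) , λ n _ part balanced odd → codegreeBound part balanced , noSteinerSystem part odd
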